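{- Let $\mathcal{M}$ be a $2$-divisible multiset of points in $\mathrm{PG}(v-1,2)$ with cardinality $7$. Then either $\mathcal{M}$ contains a point of multiplicity at least two, or there exists a line $L$ such that $\mathcal{M}-\chi_L\ge0$ (pointwise), or $\mathcal{M}$ is the characteristic function of a projective base of size $7$.
   Context: $\mathrm{PG}(v-1,2)$ is the projective geometry of $\mathbb{F}_2^v$; points, lines, hyperplanes are subspaces of dimension $1$, $2$, $v-1$. A multiset of points $\mathcal{M}$ assigns to each point $P$ a multiplicity $\mathcal{M}(P)\in\{0,1,2,\dots\}$; $\mathcal{M}(K)=\sum_{P\le K}\mathcal{M}(P)$ for a subspace $K$, and $\#\mathcal{M}=\mathcal{M}(\mathbb{F}_2^v)$. $\mathcal{M}$ is $\Delta$-divisible if $\mathcal{M}(H)\equiv\#\mathcal{M}\pmod\Delta$ for every hyperplane $H$. For a subspace or set of points $K$, $\chi_K$ has multiplicity $1$ on the points of $K$ and $0$ elsewhere. A projective base of size $n$ is a set of $n$ points such that any $n-1$ of them span an $(n-1)$-dimensional subspace. -}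

module Defs where

open import Data.Bool using (Bool; true; false; T; _∨_; _∧_; _xor_; if_then_else_; not)
open import Data.Nat using (ℕ; zero; suc; _+_; _%_; _≤_)
open import Data.Vec using (Vec; []; _∷_; replicate; zipWith)
open import Data.List using (List; []; _∷_; map; _++_)
open import Data.Nat.ListAction using (sum)
open import Data.Fin using (Fin; punchIn) renaming (zero to fzero; suc to fsuc)
open import Data.Product using (Σ; _×_; _,_; proj₁; ∃-syntax)
open import Data.Sum using (_⊎_)
open import Data.Unit using (tt)
open import Relation.Binary.PropositionalEquality using (_≡_; _≢_)

-- Vectors of F_2^v are Vec Bool v (addition = xor, multiplication = ∧).
Vect : ℕ → Set
Vect v = Vec Bool v

zeroV : (v : ℕ) → Vect v
zeroV v = replicate v false

_⊕_ : {v : ℕ} → Vect v → Vect v → Vect v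
x ⊕ y = zipWith _xor_ x y

nonzero : {v : ℕ} → Vect v → Bool
nonzero [] = false
nonzero (b ∷ x) = b ∨ nonzero x

dot : {v : ℕ} → Vect v → Vect v → Bool
dot [] [] = false
dot (a ∷ as) (x ∷ xs) = (a ∧ x) xor dot as xs

-- points of PG(v-1,2) = 1-dim subspaces = nonzero vectors of F_2^v
-- (T b is proof-irrelevant, so a point is determined by its vector)
Point : ℕ → Set
Point v = Σ (Vect v) (λ x → T (nonzero x))

allVects : (v : ℕ) → List (Vect v)
allVects zero = [] ∷ []
allVects (suc v) = map (false ∷_) (allVects v) ++ map (true ∷_) (allVects v)

Multiset : ℕ → Set
Multiset v = Point v → ℕ

private
  pick : (b : Bool) → (T b → ℕ) → ℕ
  pick true f = f tt
  pick false f = 0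

mult : {v : ℕ} → Multiset v → Vect v → ℕ
mult M x = pick (nonzero x) (λ p → M (x , p))

card : {v : ℕ} → Multiset v → ℕ
card {v} M = sum (map (mult M) (allVects v))

-- M(H_a) where H_a = { x : a·x = 0 }; for a ≠ 0 these are exactly the hyperplanes
multHyp : {v : ℕ} → Multiset v → Vect v → ℕ
multHyp {v} M a = sum (map (λ x → if dot a x then 0 else mult M x) (allVects v))

TwoDivisible : {v : ℕ} → Multiset v → Set
TwoDivisible {v} M =
  (a : Vect v) → T (nonzero a) → multHyp M a % 2 ≡ card M % 2

lincomb : {v k : ℕ} → (Fin k → Bool) → (Fin k → Vect v) → Vect v
lincomb {v} {zero} c f = zeroV v
lincomb {v} {suc k} c f =
  (if c fzero then f fzero else zeroV v) ⊕ lincomb (λ i → c (fsuc i)) (λ i → f (fsuc i))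

LinIndep : {v k : ℕ} → (Fin k → Vect v) → Set
LinIndep {v} {k} f = (c : Fin k → Bool) → lincomb c f ≡ zeroV v → (i : Fin k) → c i ≡ false

-- projective base of size n+1: any n of the points span an n-dim subspace,
-- i.e. the n remaining vectors are linearly independent
ProjectiveBase : {v : ℕ} (n : ℕ) → (Fin (suc n) → Point v) → Set
ProjectiveBase n B = (i : Fin (suc n)) → LinIndep (λ j → proj₁ (B (punchIn i j)))

IsCharOf : {v k : ℕ} → Multiset v → (Fin k → Point v) → Set
IsCharOf {v} {k} M B =
  ((i : Fin k) → M (B i) ≡ 1) ×
  ((P : Point v) → ((i : Fin k) → proj₁ P ≢ proj₁ (B i)) → M P ≡ 0)

-- some line L = {x, y, x+y} with M - χ_L ≥ 0
ContainsLine : {v : ℕ} → Multiset v → Set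
ContainsLine {v} M =
  Σ (Point v) λ x → Σ (Point v) λ y →
    (proj₁ x ≢ proj₁ y) × (1 ≤ M x) × (1 ≤ M y) × (1 ≤ mult M (proj₁ x ⊕ proj₁ y))

-- Once no point is doubled, M is the characteristic function of a set S of 7 points.
-- The number of points of S off the hyperplane a·x = 0 has the parity of a·(Σ S), so
-- 2-divisibility forces a·(Σ S) = 0 for every a, i.e. Σ S = 0.  If S contains no line,
-- S is a cap, and in a cap no 1, 2 or 3 points sum to zero.  Since Σ S = 0, the complement
-- of a dependency among the 7 points is again a dependency, and one of the two has at most
-- 3 points; so the only dependencies are the empty and the full one, and any 6 of the
-- points are independent.
module Submission where

open import Defs
open import Data.Nat using (ℕ; _≤_)
open import Data.Fin using (Fin)
open import Data.Product using (Σ; _×_)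
open import Data.Sum using (_⊎_)
open import Relation.Binary.PropositionalEquality using (_≡_)

open import Level using (0ℓ)
open import Function using (id; _∘_; const)
open import Data.Bool using (Bool; true; false; T; _∧_; _xor_; if_then_else_; not)
open import Data.Bool.Properties
  using (xor-same; xor-assoc; xor-comm; xor-identityˡ; xor-identityʳ; ∧-distribˡ-xor;
         ∧-zeroʳ; ∧-identityʳ; not-involutive; T?; xor-∧-commutativeRing)
open import Data.Nat using (zero; suc; _+_; _%_; _≤?_; z≤n; s≤s)
open import Data.Nat.Properties
  using (≤-refl; ≤-reflexive; ≤-trans; ≤-pred; ≰⇒>; +-comm; +-suc; +-monoˡ-≤; +-cancelˡ-≤; n≤1⇒n≡0∨n≡1)
open import Data.Nat.DivMod using ([m+n]%n≡m%n)
open import Data.Nat.ListAction using (sum)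
open import Data.Vec using ([]; _∷_)
open import Data.Vec.Properties using (zipWith-assoc; zipWith-comm; zipWith-identityˡ; zipWith-identityʳ; ∷-injectiveʳ)
open import Data.Vec.Functional using (insertAt; tail)
open import Data.Vec.Functional.Properties using (insertAt-punchIn; insertAt-lookup)
open import Data.Fin using (punchIn) renaming (zero to fzero; suc to fsuc)
open import Data.Fin.Properties using (suc-injective; any?) renaming (_≟_ to _≟ᶠ_)
open import Data.Product using (_,_; proj₁; proj₂)
open import Data.Sum using (inj₁; inj₂)
open import Data.Empty using (⊥-elim)
open import Data.Unit using (tt)
open import Data.List using (List; []; _∷_; map; length; foldr; lookup; filterᵇ)
open import Data.List.Properties using (length-map; map-∘)
open import Data.List.Membership.Propositional using (_∈_; _∉_; lose)
open import Data.List.Membership.Propositional.Properties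
  using (∈-map⁺; ∈-map⁻; ∈-++⁺ˡ; ∈-++⁺ʳ; ∈-filter⁺; ∈-filter⁻; ∈-lookup)
open import Data.List.Relation.Unary.Any as Any using (here; there)
open import Data.List.Relation.Unary.Any.Properties using (lookup-index)
open import Data.List.Relation.Unary.All as All using (All; []; _∷_)
open import Data.List.Relation.Unary.All.Properties using () renaming (map⁺ to All-map⁺)
open import Data.List.Relation.Unary.AllPairs using ([]; _∷_)
open import Data.List.Relation.Unary.Unique.Propositional using (Unique)
import Data.List.Relation.Unary.Unique.Propositional.Properties as Unique
open import Relation.Binary.PropositionalEquality
  using (_≢_; refl; sym; trans; cong; cong₂; subst; isEquivalence; module ≡-Reasoning)
open import Relation.Nullary using (yes; no; ¬_; contradiction)
open import Relation.Nullary.Decidable using (_×-dec_; ¬?)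
open import Algebra.Bundles using (AbelianGroup; CommutativeRing)
open import Algebra.Structures using (IsAbelianGroup)
import Algebra.Properties.CommutativeSemigroup as CommSemigroupProperties
import Algebra.Properties.Group as GroupProperties

⊕-self : ∀ {v} (x : Vect v) → x ⊕ x ≡ zeroV v
⊕-self []      = refl
⊕-self (b ∷ x) = cong₂ _∷_ (xor-same b) (⊕-self x)

⊕-isAbelianGroup : ∀ v → IsAbelianGroup _≡_ (_⊕_ {v}) (zeroV v) id
⊕-isAbelianGroup v = record
  { isGroup = record
    { isMonoid = record
      { isSemigroup = record
        { isMagma = record { isEquivalence = isEquivalence ; ∙-cong = cong₂ _⊕_ }
        ; assoc   = zipWith-assoc xor-assoc }
      ; identity = zipWith-identityˡ xor-identityˡ , zipWith-identityʳ xor-identityʳ }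
    ; inverse = ⊕-self , ⊕-self
    ; ⁻¹-cong = id }
  ; comm = zipWith-comm xor-comm }

⊕-abelianGroup : ℕ → AbelianGroup 0ℓ 0ℓ
⊕-abelianGroup v = record { isAbelianGroup = ⊕-isAbelianGroup v }

module _ {v : ℕ} where
  open AbelianGroup (⊕-abelianGroup v) public
    using () renaming (assoc to ⊕-assoc; identityˡ to ⊕-identityˡ; identityʳ to ⊕-identityʳ)
  open CommSemigroupProperties (AbelianGroup.commutativeSemigroup (⊕-abelianGroup v)) public
    using () renaming (interchange to ⊕-interchange)
  open GroupProperties (AbelianGroup.group (⊕-abelianGroup v)) public
    using () renaming (x∙y⁻¹≈ε⇒x≈y to ⊕≡0⇒≡)

open CommSemigroupProperties (CommutativeRing.+-commutativeSemigroup xor-∧-commutativeRing)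
  using () renaming (interchange to xor-interchange)
open GroupProperties (CommutativeRing.+-group xor-∧-commutativeRing)
  using () renaming (identityʳ-unique to xor-identityʳ-unique)

Σ⊕ : ∀ {v} → List (Vect v) → Vect v
Σ⊕ {v} = foldr _⊕_ (zeroV v)

dot-⊕ : ∀ {v} (a x y : Vect v) → dot a (x ⊕ y) ≡ dot a x xor dot a y
dot-⊕ []       []       []       = refl
dot-⊕ (a ∷ as) (x ∷ xs) (y ∷ ys) = begin
  (a ∧ (x xor y)) xor dot as (xs ⊕ ys)
    ≡⟨ cong₂ _xor_ (∧-distribˡ-xor a x y) (dot-⊕ as xs ys) ⟩
  ((a ∧ x) xor (a ∧ y)) xor (dot as xs xor dot as ys)
    ≡⟨ xor-interchange (a ∧ x) (a ∧ y) (dot as xs) (dot as ys) ⟩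
  ((a ∧ x) xor dot as xs) xor ((a ∧ y) xor dot as ys) ∎
  where open ≡-Reasoning

dot-zeroˡ : ∀ {v} (x : Vect v) → dot (zeroV v) x ≡ false
dot-zeroˡ []       = refl
dot-zeroˡ (_ ∷ xs) = dot-zeroˡ xs

dot-zeroʳ : ∀ {v} (a : Vect v) → dot a (zeroV v) ≡ false
dot-zeroʳ []       = refl
dot-zeroʳ (a ∷ as) = cong₂ _xor_ (∧-zeroʳ a) (dot-zeroʳ as)

dot-nondegenerate : ∀ {v} (x : Vect v) → (∀ a → T (nonzero a) → dot a x ≡ false) → x ≡ zeroV v
dot-nondegenerate []            _ = refl
dot-nondegenerate {suc v} (b ∷ x) x⊥ = cong₂ _∷_ b≡false (dot-nondegenerate x (λ a → x⊥ (false ∷ a)))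
  where
  b≡false : b ≡ false
  b≡false = begin
    b                              ≡⟨ sym (xor-identityʳ b) ⟩
    b xor false                    ≡⟨ cong (b xor_) (sym (dot-zeroˡ x)) ⟩
    dot (true ∷ zeroV v) (b ∷ x)   ≡⟨ x⊥ (true ∷ zeroV v) tt ⟩
    false                          ∎
    where open ≡-Reasoning

odd : ℕ → Bool
odd zero    = false
odd (suc n) = not (odd n)

odd-+ : ∀ m n → odd (m + n) ≡ odd m xor odd n
odd-+ zero    n = refl
odd-+ (suc m) n = trans (cong not (odd-+ m n)) (sym (xor-assoc true (odd m) (odd n)))

odd-%2 : ∀ n → odd (n % 2) ≡ odd n
odd-%2 zero          = refl
odd-%2 (suc zero)    = refl
odd-%2 (suc (suc n)) = begin
  odd ((2 + n) % 2)   ≡⟨ cong (λ k → odd (k % 2)) (+-comm 2 n) ⟩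
  odd ((n + 2) % 2)   ≡⟨ cong odd ([m+n]%n≡m%n n 2) ⟩
  odd (n % 2)         ≡⟨ odd-%2 n ⟩
  odd n               ≡⟨ sym (not-involutive (odd n)) ⟩
  not (not (odd n))   ∎
  where open ≡-Reasoning

%2-cong-odd : ∀ m n → m % 2 ≡ n % 2 → odd m ≡ odd n
%2-cong-odd m n e = trans (sym (odd-%2 m)) (trans (cong odd e) (odd-%2 n))

∈-allVects : ∀ {v} (x : Vect v) → x ∈ allVects v
∈-allVects []                = here refl
∈-allVects {suc v} (false ∷ x) = ∈-++⁺ˡ (∈-map⁺ (false ∷_) (∈-allVects x))
∈-allVects {suc v} (true ∷ x)  = ∈-++⁺ʳ (map (false ∷_) (allVects v)) (∈-map⁺ (true ∷_) (∈-allVects x))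

allVects-unique : ∀ v → Unique (allVects v)
allVects-unique zero    = [] ∷ []
allVects-unique (suc v) =
  Unique.++⁺ (Unique.map⁺ ∷-injectiveʳ (allVects-unique v)) (Unique.map⁺ ∷-injectiveʳ (allVects-unique v)) disjoint
  where
  disjoint : ∀ {y} → ¬ (y ∈ map (false ∷_) (allVects v) × y ∈ map (true ∷_) (allVects v))
  disjoint (p , q) with ∈-map⁻ (false ∷_) p | ∈-map⁻ (true ∷_) q
  ... | _ , _ , refl | _ , _ , ()

Unique-lookup-injective : ∀ {A : Set} (xs : List A) → Unique xs →
  ∀ {i j} → i ≢ j → lookup xs i ≢ lookup xs j
Unique-lookup-injective (x ∷ xs) (x∉ ∷ u) {fzero}  {fzero}  i≢j = contradiction refl i≢j
Unique-lookup-injective (x ∷ xs) (x∉ ∷ u) {fzero}  {fsuc j} _   = All.lookup x∉ (∈-lookup j)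
Unique-lookup-injective (x ∷ xs) (x∉ ∷ u) {fsuc i} {fzero}  _   = All.lookup x∉ (∈-lookup i) ∘ sym
Unique-lookup-injective (x ∷ xs) (x∉ ∷ u) {fsuc i} {fsuc j} i≢j = Unique-lookup-injective xs u (i≢j ∘ cong fsuc)

mult-point : ∀ {v} (M : Multiset v) (x : Vect v) (p : T (nonzero x)) → mult M x ≡ M (x , p)
mult-point M (true  ∷ x) tt = refl
mult-point M (false ∷ x) p  = mult-point (λ q → M (false ∷ proj₁ q , proj₂ q)) x p

mult-zeroV : ∀ {v} (M : Multiset v) → mult M (zeroV v) ≡ 0
mult-zeroV {zero}  M = refl
mult-zeroV {suc v} M = mult-zeroV (λ q → M (false ∷ proj₁ q , proj₂ q))

mult-nonzero : ∀ {v} (M : Multiset v) (x : Vect v) → 1 ≤ mult M x → T (nonzero x)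
mult-nonzero M (true  ∷ x) _ = tt
mult-nonzero M (false ∷ x) h = mult-nonzero (λ q → M (false ∷ proj₁ q , proj₂ q)) x h

toPoint : ∀ {v} (M : Multiset v) (x : Vect v) → 1 ≤ mult M x → Point v
toPoint M x h = x , mult-nonzero M x h

M-toPoint : ∀ {v} (M : Multiset v) (x : Vect v) (h : 1 ≤ mult M x) → M (toPoint M x h) ≡ mult M x
M-toPoint M x h = sym (mult-point M x (mult-nonzero M x h))

module _ {v : ℕ} (M : Multiset v) where

  oddPart : List (Vect v) → List (Vect v)
  oddPart = filterᵇ (odd ∘ mult M)

  offHyperplane : Vect v → Vect v → ℕ
  offHyperplane a x = if dot a x then 0 else mult M x

  hyperplane-parity : ∀ a L →
    odd (sum (map (mult M) L)) ≡ odd (sum (map (offHyperplane a) L)) xor dot a (Σ⊕ (oddPart L))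
  hyperplane-parity a []      = sym (dot-zeroʳ a)
  hyperplane-parity a (x ∷ L) = begin
    odd (mult M x + s)
      ≡⟨ odd-+ (mult M x) s ⟩
    odd (mult M x) xor odd s
      ≡⟨ cong₂ _xor_ (odd-split (dot a x) (mult M x)) (hyperplane-parity a L) ⟩
    (odd (offHyperplane a x) xor (dot a x ∧ odd (mult M x))) xor (odd s₀ xor dot a (Σ⊕ (oddPart L)))
      ≡⟨ xor-interchange (odd (offHyperplane a x)) _ (odd s₀) _ ⟩
    (odd (offHyperplane a x) xor odd s₀) xor ((dot a x ∧ odd (mult M x)) xor dot a (Σ⊕ (oddPart L)))
      ≡⟨ cong₂ _xor_ (sym (odd-+ (offHyperplane a x) s₀)) (sym dot-oddPart-∷) ⟩
    odd (offHyperplane a x + s₀) xor dot a (Σ⊕ (oddPart (x ∷ L))) ∎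
    where
    open ≡-Reasoning
    s s₀ : ℕ
    s  = sum (map (mult M) L)
    s₀ = sum (map (offHyperplane a) L)

    odd-split : ∀ d m → odd m ≡ odd (if d then 0 else m) xor (d ∧ odd m)
    odd-split true  m = refl
    odd-split false m = sym (xor-identityʳ (odd m))

    dot-oddPart-∷ : dot a (Σ⊕ (oddPart (x ∷ L))) ≡ (dot a x ∧ odd (mult M x)) xor dot a (Σ⊕ (oddPart L))
    dot-oddPart-∷ with odd (mult M x)
    ... | true  = trans (dot-⊕ a x _) (cong (_xor _) (sym (∧-identityʳ (dot a x))))
    ... | false = cong (_xor _) (sym (∧-zeroʳ (dot a x)))

  twoDivisible⇒Σ⊕oddPart≡0 : TwoDivisible M → Σ⊕ (oddPart (allVects v)) ≡ zeroV v
  twoDivisible⇒Σ⊕oddPart≡0 div = dot-nondegenerate _ λ a a≢0 →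
    xor-identityʳ-unique _ _ (trans (sym (hyperplane-parity a (allVects v)))
                                    (%2-cong-odd (card M) (multHyp M a) (sym (div a a≢0))))

  module _ (simple : ∀ x → mult M x ≤ 1) where

    sum≡length-oddPart : ∀ L → sum (map (mult M) L) ≡ length (oddPart L)
    sum≡length-oddPart []      = refl
    sum≡length-oddPart (x ∷ L) with mult M x | simple x
    ... | 0 | z≤n     = sum≡length-oddPart L
    ... | 1 | s≤s z≤n = cong suc (sum≡length-oddPart L)

    ∈-oddPart⇒≡1 : ∀ {L y} → y ∈ oddPart L → mult M y ≡ 1
    ∈-oddPart⇒≡1 {L} {y} y∈ with n≤1⇒n≡0∨n≡1 (simple y)
    ... | inj₂ m≡1 = m≡1
    ... | inj₁ m≡0 = ⊥-elim (subst (T ∘ odd) m≡0 (proj₂ (∈-filter⁻ (T? ∘ odd ∘ mult M) {xs = L} y∈)))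

    ∉-oddPart⇒≡0 : ∀ {y} → y ∉ oddPart (allVects v) → mult M y ≡ 0
    ∉-oddPart⇒≡0 {y} y∉ with n≤1⇒n≡0∨n≡1 (simple y)
    ... | inj₁ m≡0 = m≡0
    ... | inj₂ m≡1 = contradiction (∈-filter⁺ (T? ∘ odd ∘ mult M) (∈-allVects y) (subst (T ∘ odd) (sym m≡1) tt)) y∉

doublePoint⊎simple : ∀ {v} (M : Multiset v) → Σ (Point v) (λ P → 2 ≤ M P) ⊎ (∀ x → mult M x ≤ 1)
doublePoint⊎simple {v} M with Any.any? (λ x → 2 ≤? mult M x) (allVects v)
... | no ¬double = inj₂ λ x → ≤-pred (≰⇒> (¬double ∘ lose (∈-allVects x)))
... | yes double with Any.satisfied double
...   | x , 2≤m = inj₁ (toPoint M x 1≤m , subst (2 ≤_) (sym (M-toPoint M x 1≤m)) 2≤m)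
  where
  1≤m : 1 ≤ mult M x
  1≤m = ≤-trans (s≤s z≤n) 2≤m

support : ∀ {n} → (Fin n → Bool) → List (Fin n)
support {zero}  c = []
support {suc n} c = (if c fzero then fzero ∷_ else id) (map fsuc (support (tail c)))

lincomb-support : ∀ {v n} (c : Fin n → Bool) (x : Fin n → Vect v) → lincomb c x ≡ Σ⊕ (map x (support c))
lincomb-support {n = zero}  c x = refl
lincomb-support {n = suc n} c x = begin
  lincomb c x                                       ≡⟨ cong (term₀ ⊕_) (lincomb-support (tail c) (tail x)) ⟩
  term₀ ⊕ Σ⊕ (map (tail x) (support (tail c)))       ≡⟨ cong (λ l → term₀ ⊕ Σ⊕ l) (map-∘ (support (tail c))) ⟩
  term₀ ⊕ Σ⊕ (map x (map fsuc (support (tail c))))   ≡⟨ cons (c fzero) ⟩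
  Σ⊕ (map x (support c))                            ∎
  where
  open ≡-Reasoning
  term₀ : Vect _
  term₀ = if c fzero then x fzero else zeroV _
  cons : ∀ b {l} → (if b then x fzero else zeroV _) ⊕ Σ⊕ (map x l) ≡ Σ⊕ (map x ((if b then fzero ∷_ else id) l))
  cons true  = refl
  cons false = ⊕-identityˡ _

length-support-not : ∀ {n} (c : Fin n → Bool) → length (support c) + length (support (not ∘ c)) ≡ n
length-support-not {zero}  c = refl
length-support-not {suc n} c = trans (split (c fzero)) (cong suc (begin
  length (map fsuc (support (tail c))) + length (map fsuc (support (not ∘ tail c)))
    ≡⟨ cong₂ _+_ (length-map fsuc (support (tail c))) (length-map fsuc (support (not ∘ tail c))) ⟩
  length (support (tail c)) + length (support (not ∘ tail c))
    ≡⟨ length-support-not (tail c) ⟩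
  n ∎))
  where
  open ≡-Reasoning
  split : ∀ b {s t : List (Fin (suc n))} →
    length ((if b then fzero ∷_ else id) s) + length ((if not b then fzero ∷_ else id) t) ≡ suc (length s + length t)
  split true  = refl
  split false = +-suc _ _

support-unique : ∀ {n} (c : Fin n → Bool) → Unique (support c)
support-unique {zero}  c = []
support-unique {suc n} c with c fzero
... | true  = All-map⁺ (All.tabulate λ _ ()) ∷ Unique.map⁺ suc-injective (support-unique (tail c))
... | false = Unique.map⁺ suc-injective (support-unique (tail c))

∈-support : ∀ {n} (c : Fin n → Bool) {i} → c i ≡ true → i ∈ support c
∈-support {suc n} c {fzero}  c₀ rewrite c₀ = here refl
∈-support {suc n} c {fsuc i} cᵢ with c fzero
... | true  = there (∈-map⁺ fsuc (∈-support (tail c) cᵢ))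
... | false = ∈-map⁺ fsuc (∈-support (tail c) cᵢ)

support≡[]⇒≡false : ∀ {n} (c : Fin n → Bool) → support c ≡ [] → ∀ i → c i ≡ false
support≡[]⇒≡false c empty i with c i in cᵢ
... | false = refl
... | true with subst (i ∈_) empty (∈-support c cᵢ)
...   | ()

lincomb-not : ∀ {v n} (c : Fin n → Bool) (x : Fin n → Vect v) →
  lincomb (not ∘ c) x ≡ lincomb c x ⊕ lincomb (const true) x
lincomb-not {n = zero}  c x = sym (⊕-identityˡ _)
lincomb-not {n = suc n} c x = begin
  select (not (c fzero)) ⊕ lincomb (not ∘ tail c) (tail x)
    ≡⟨ cong₂ _⊕_ (select-not (c fzero)) (lincomb-not (tail c) (tail x)) ⟩
  (select (c fzero) ⊕ x fzero) ⊕ (lincomb (tail c) (tail x) ⊕ lincomb (const true) (tail x))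
    ≡⟨ ⊕-interchange (select (c fzero)) _ _ _ ⟨
  (select (c fzero) ⊕ lincomb (tail c) (tail x)) ⊕ (x fzero ⊕ lincomb (const true) (tail x)) ∎
  where
  open ≡-Reasoning
  select : Bool → Vect _
  select b = if b then x fzero else zeroV _
  select-not : ∀ b → select (not b) ≡ select b ⊕ x fzero
  select-not true  = sym (⊕-self (x fzero))
  select-not false = sym (⊕-identityˡ (x fzero))

lincomb-insertAt : ∀ {v n} (c : Fin n → Bool) (i : Fin (suc n)) (x : Fin (suc n) → Vect v) →
  lincomb (insertAt c i false) x ≡ lincomb c (x ∘ punchIn i)
lincomb-insertAt c fzero x = ⊕-identityˡ _
lincomb-insertAt {n = suc n} c (fsuc i) x = cong (_ ⊕_) (lincomb-insertAt (tail c) i (tail x))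

lincomb-true-lookup : ∀ {v} (S : List (Vect v)) → lincomb (const true) (lookup S) ≡ Σ⊕ S
lincomb-true-lookup []      = refl
lincomb-true-lookup (s ∷ S) = cong (s ⊕_) (lincomb-true-lookup S)

m+n≤7⇒m≤3⊎n≤3 : ∀ {m n} → m + n ≤ 7 → m ≤ 3 ⊎ n ≤ 3
m+n≤7⇒m≤3⊎n≤3 {m} {n} m+n≤7 with m ≤? 3
... | yes m≤3 = inj₁ m≤3
... | no  m≰3 = inj₂ (+-cancelˡ-≤ 4 n 3 (≤-trans (+-monoˡ-≤ n (≰⇒> m≰3)) m+n≤7))

-- No three points of a cap are collinear: the third point on the line through x i and x j is x i ⊕ x j.
record IsCap {v n} (x : Fin n → Vect v) : Set where
  field
    ≢zero     : ∀ i → x i ≢ zeroV v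
    injective : ∀ {i j} → i ≢ j → x i ≢ x j
    noLine    : ∀ {i j} k → i ≢ j → x i ⊕ x j ≢ x k

module _ {v n} {x : Fin n → Vect v} (cap : IsCap x) where
  open IsCap cap

  cap-shortSum≡0⇒[] : (s : List (Fin n)) → Unique s → length s ≤ 3 → Σ⊕ (map x s) ≡ zeroV v → s ≡ []
  cap-shortSum≡0⇒[] []          _ _ _ = refl
  cap-shortSum≡0⇒[] (i ∷ [])    _ _ e = ⊥-elim (≢zero i (trans (sym (⊕-identityʳ (x i))) e))
  cap-shortSum≡0⇒[] (i ∷ j ∷ []) ((i≢j ∷ []) ∷ _) _ e =
    ⊥-elim (injective i≢j (⊕≡0⇒≡ (x i) (x j) (trans (cong (x i ⊕_) (sym (⊕-identityʳ (x j)))) e)))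
  cap-shortSum≡0⇒[] (i ∷ j ∷ k ∷ []) ((i≢j ∷ _) ∷ _) _ e =
    ⊥-elim (noLine k i≢j (⊕≡0⇒≡ (x i ⊕ x j) (x k)
      (trans (⊕-assoc (x i) (x j) (x k)) (trans (cong (λ y → x i ⊕ (x j ⊕ y)) (sym (⊕-identityʳ (x k)))) e))))
  cap-shortSum≡0⇒[] (_ ∷ _ ∷ _ ∷ _ ∷ _) _ (s≤s (s≤s (s≤s ()))) _

  cap-shortDependency⇒trivial : ∀ c → lincomb c x ≡ zeroV v → length (support c) ≤ 3 → ∀ i → c i ≡ false
  cap-shortDependency⇒trivial c dep short = support≡[]⇒≡false c
    (cap-shortSum≡0⇒[] (support c) (support-unique c) short (trans (sym (lincomb-support c x)) dep))

  cap-dependency : n ≤ 7 → lincomb (const true) x ≡ zeroV v →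
    ∀ c → lincomb c x ≡ zeroV v → (∀ i → c i ≡ false) ⊎ (∀ i → c i ≡ true)
  cap-dependency n≤7 total c dep with m+n≤7⇒m≤3⊎n≤3 (≤-trans (≤-reflexive (length-support-not c)) n≤7)
  ... | inj₁ short = inj₁ (cap-shortDependency⇒trivial c dep short)
  ... | inj₂ short = inj₂ λ i →
    trans (sym (not-involutive (c i))) (cong not (cap-shortDependency⇒trivial (not ∘ c) dep′ short i))
    where
    dep′ : lincomb (not ∘ c) x ≡ zeroV v
    dep′ = trans (lincomb-not c x) (trans (cong₂ _⊕_ dep total) (⊕-identityˡ _))

cap⇒projectiveBase : ∀ {v n} → suc n ≤ 7 → (B : Fin (suc n) → Point v) → IsCap (proj₁ ∘ B) →
  lincomb (const true) (proj₁ ∘ B) ≡ zeroV v → ProjectiveBase n B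
cap⇒projectiveBase size≤7 B cap total i c dep j
  with cap-dependency cap size≤7 total (insertAt c i false) (trans (lincomb-insertAt c i (proj₁ ∘ B)) dep)
... | inj₁ allFalse = trans (sym (insertAt-punchIn c i false j)) (allFalse (punchIn i j))
... | inj₂ allTrue  = contradiction (trans (sym (allTrue i)) (insertAt-lookup c i false)) λ ()

module _ {v : ℕ} (M : Multiset v) (S : List (Vect v)) (∈S⇒≡1 : ∀ {y} → y ∈ S → mult M y ≡ 1) where

  lookupPoint : Fin (length S) → Point v
  lookupPoint i = toPoint M (lookup S i) (≤-reflexive (sym (∈S⇒≡1 (∈-lookup i))))

  M-lookupPoint : ∀ i → M (lookupPoint i) ≡ 1
  M-lookupPoint i = trans (M-toPoint M _ _) (∈S⇒≡1 (∈-lookup i))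

  lineOrCap : Unique S → ContainsLine M ⊎ IsCap (lookup S)
  lineOrCap unique with any? (λ i → any? (λ j → ¬? (i ≟ᶠ j) ×-dec (1 ≤? mult M (lookup S i ⊕ lookup S j))))
  ... | yes (i , j , i≢j , 1≤m) =
    inj₁ (lookupPoint i , lookupPoint j , Unique-lookup-injective S unique i≢j ,
          ≤-reflexive (sym (M-lookupPoint i)) , ≤-reflexive (sym (M-lookupPoint j)) , 1≤m)
  ... | no noLine = inj₂ record
    { ≢zero     = λ i onZero → contradiction (trans (sym (∈S⇒≡1 (∈-lookup i)))
                                               (trans (cong (mult M) onZero) (mult-zeroV M))) λ ()
    ; injective = Unique-lookup-injective S unique
    ; noLine    = λ {i} {j} k i≢j onLine →
        noLine (i , j , i≢j , ≤-reflexive (sym (trans (cong (mult M) onLine) (∈S⇒≡1 (∈-lookup k)))))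
    }

-- Matching S against a 7-element list makes Fin (length S) compute to Fin 7.
sevenPointSet : ∀ {v} (M : Multiset v) (S : List (Vect v)) → length S ≡ 7 → Unique S →
  (∀ {y} → y ∈ S → mult M y ≡ 1) → (∀ {y} → y ∉ S → mult M y ≡ 0) → Σ⊕ S ≡ zeroV v →
  ContainsLine M ⊎ Σ (Fin 7 → Point v) (λ B → ProjectiveBase 6 B × IsCharOf M B)
sevenPointSet M S@(_ ∷ _ ∷ _ ∷ _ ∷ _ ∷ _ ∷ _ ∷ []) refl unique ∈S⇒≡1 ∉S⇒≡0 ΣS≡0
  with lineOrCap M S ∈S⇒≡1 unique
... | inj₁ line = inj₁ line
... | inj₂ cap  = inj₂ (B , cap⇒projectiveBase ≤-refl B cap (trans (lincomb-true-lookup S) ΣS≡0) ,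
                        M-lookupPoint M S ∈S⇒≡1 , outside)
  where
  B : Fin 7 → Point _
  B = lookupPoint M S ∈S⇒≡1
  outside : ∀ P → (∀ i → proj₁ P ≢ proj₁ (B i)) → M P ≡ 0
  outside (y , p) y∉B = trans (sym (mult-point M y p)) (∉S⇒≡0 λ y∈S → y∉B (Any.index y∈S) (lookup-index y∈S))

proposition18 : (v : ℕ) (M : Multiset v) → TwoDivisible M → card M ≡ 7 →
    (Σ (Point v) (λ P → 2 ≤ M P))
    ⊎ (ContainsLine M
    ⊎ Σ (Fin 7 → Point v) (λ B → ProjectiveBase 6 B × IsCharOf M B))
proposition18 v M twoDivisible card≡7 with doublePoint⊎simple M
... | inj₁ doublePoint = inj₁ doublePoint
... | inj₂ simple      = inj₂ (sevenPointSet M S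
  (trans (sym (sum≡length-oddPart M simple (allVects v))) card≡7)
  (Unique.filter⁺ (T? ∘ odd ∘ mult M) (allVects-unique v))
  (∈-oddPart⇒≡1 M simple {allVects v})
  (∉-oddPart⇒≡0 M simple)
  (twoDivisible⇒Σ⊕oddPart≡0 M twoDivisible))
  where
  S : List (Vect v)
  S = oddPart M (allVects v)
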